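{- For every $n\in\mathbb{N}$, the Sprague-Grundy value of Grim played on the path $P_n$ equals the Sprague-Grundy value of the octal game Octal $.6$ played on a single heap of $n$ chips.
   Context: Grim: two players alternate moves on a finite simple undirected graph; isolated vertices are deleted before play; a move chooses a remaining vertex and deletes it with its incident edges, then deletes all vertices that have become isolated; the last player to move wins. In particular $P_1$ (a single vertex) admits no move. Octal $.6$: a normal-play impartial game on heaps of chips; a move consists of removing exactly one chip from a single heap, and the remaining chips of that heap must be left as exactly one or exactly two non-empty heaps (so a heap of one chip admits no move). For a position $X$ of a normal-play impartial game, the Sprague-Grundy value is defined recursively by $\mathcal{SG}(X)=\mathrm{mex}\{\mathcal{SG}(Y): Y \text{ a position reachable from } X \text{ in one move}\}$, where $\mathrm{mex}$ of a set of non-negative integers is the least non-negative integer not in it. -}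

module Defs where

open import Data.Nat using (ℕ; zero; suc; _+_; _∸_; _≡ᵇ_)
open import Data.Nat.Properties using (≡ᵇ⇒≡)
open import Data.Bool using (Bool; true; false; _∨_; _∧_; not; if_then_else_; T)
open import Data.Bool.Properties using (∨-comm)
open import Data.Fin using (Fin; toℕ)
open import Data.List using (List; []; _∷_; map; _++_; filter; upTo; allFin; length)
open import Data.Bool.ListAction using (any)
open import Data.Nat.ListAction using (sum)
open import Data.Vec using (Vec; lookup; replicate; _[_]≔_; tabulate)
open import Relation.Binary.PropositionalEquality using (_≡_; refl)
open import Relation.Nullary using (¬_)
open import Data.Empty using (⊥)

-- mex of a finite list of naturals: least natural number not in the list.
-- (The least absent number is ≤ length xs, so searching 0..length xs suffices.)

elemᵇ : ℕ → List ℕ → Bool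
elemᵇ k []       = false
elemᵇ k (x ∷ xs) = (k ≡ᵇ x) ∨ elemᵇ k xs

mexFrom : ℕ → ℕ → List ℕ → ℕ
mexFrom zero    k xs = k
mexFrom (suc f) k xs = if elemᵇ k xs then mexFrom f (suc k) xs else k

mex : List ℕ → ℕ
mex xs = mexFrom (length xs) 0 xs

record SimpleGraph (n : ℕ) : Set where
  field
    adj    : Fin n → Fin n → Bool
    sym    : ∀ i j → adj i j ≡ adj j i
    irrefl : ∀ i → adj i i ≡ false

open SimpleGraph public

-- Grim positions on a graph G: the set of remaining vertices (Vec Bool n);
-- the remaining graph is the subgraph of G induced on them.

module Grim {n : ℕ} (G : SimpleGraph n) where

  Alive : Set
  Alive = Vec Bool n

  hasNbr : Alive → Fin n → Bool
  hasNbr S v = any (λ u → lookup S u ∧ adj G v u) (allFin n)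

  -- delete all vertices that are isolated in the induced subgraph on S
  -- (one pass suffices: an isolated vertex is nobody's neighbour)
  prune : Alive → Alive
  prune S = tabulate (λ v → lookup S v ∧ hasNbr S v)

  move : Alive → Fin n → Alive
  move S v = prune (S [ v ]≔ false)

  options : Alive → List Alive
  options S = map (move S) (filter (λ v → Data.Bool._≟_ (lookup S v) true) (allFin n))

  -- Sprague-Grundy value with fuel; every move deletes at least one vertex,
  -- so fuel n (the number of vertices) is always sufficient.
  sgFuel : ℕ → Alive → ℕ
  sgFuel zero    S = 0
  sgFuel (suc f) S = mex (map (sgFuel f) (options S))

  start : Alive
  start = prune (replicate n true)

  sg : ℕ
  sg = sgFuel n start

sgGrim : {n : ℕ} → SimpleGraph n → ℕ
sgGrim G = Grim.sg G

pathAdj : (n : ℕ) → Fin n → Fin n → Bool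
pathAdj n i j = (suc (toℕ i) ≡ᵇ toℕ j) ∨ (suc (toℕ j) ≡ᵇ toℕ i)

private
  sucᵇ-false : ∀ m → (suc m ≡ᵇ m) ≡ false
  sucᵇ-false zero    = refl
  sucᵇ-false (suc m) = sucᵇ-false m

pathGraph : (n : ℕ) → SimpleGraph n
pathGraph n = record
  { adj    = pathAdj n
  ; sym    = λ i j → ∨-comm (suc (toℕ i) ≡ᵇ toℕ j) (suc (toℕ j) ≡ᵇ toℕ i)
  ; irrefl = λ i → irr (toℕ i)
  }
  where
  irr : ∀ m → ((suc m ≡ᵇ m) ∨ (suc m ≡ᵇ m)) ≡ false
  irr m rewrite sucᵇ-false m = refl

-- Octal .6 : positions are lists of heap sizes. A move removes one chip
-- from a heap h, leaving the remaining h-1 chips as exactly one or exactly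
-- two non-empty heaps.

splitHeap : ℕ → List (List ℕ)
splitHeap zero          = []
splitHeap (suc zero)    = []
splitHeap (suc (suc k)) =
  (suc k ∷ []) ∷ map (λ a → suc a ∷ (k ∸ a) ∷ []) (upTo k)
  -- remaining r = k+1 chips: one heap r, or two heaps (a+1, k-a) with 0 ≤ a < k

octalMoves : List ℕ → List (List ℕ)
octalMoves []       = []
octalMoves (h ∷ hs) = map (_++ hs) (splitHeap h) ++ map (h ∷_) (octalMoves hs)

-- each move lowers the total number of chips by one, so fuel = total chips
sgOctalFuel : ℕ → List ℕ → ℕ
sgOctalFuel zero    p = 0
sgOctalFuel (suc f) p = mex (map (sgOctalFuel f) (octalMoves p))

sgOctal : List ℕ → ℕ
sgOctal p = sgOctalFuel (sum p) p

-- After pruning, a Grim position on a path is determined by the lengths of its maximal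
-- runs of remaining vertices, all of them at least 2.  Deleting a vertex from a run of
-- length 1 + a + b leaves runs of lengths a and b, and pruning then discards runs of
-- length 1; in Octal .6 a heap 1 + a + b likewise becomes heaps a and b, and heaps of
-- size 0 or 1 are inert.  Hence "the runs of S are the heaps of p of size ≥ 2" is a
-- bisimulation, and since both Grundy values are evaluated with the same fuel n, the
-- two mex recursions agree level by level.
module Submission where

open import Defs hiding (sym)
open import Data.Nat using (ℕ; zero; suc; _+_; _∸_; _≤_; _<_; z≤n; s≤s; z<s; _≡ᵇ_; _≤?_)
open import Data.Nat.Properties
  using (≤-refl; ≤-pred; ≤-<-trans; <-cmp; n≮n; m+n≮m; m≤n⇒m<n∨m≡n; m<n⇒m<1+n; m<m+n;
         m<n⇒0<n∸m; m+n∸m≡n; m+[n∸m]≡n; <⇒≤; +-suc; +-identityʳ; +-cancelˡ-≡;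
         suc-injective; ≡ᵇ⇒≡; ≡⇒≡ᵇ)
open import Data.Bool using (Bool; true; false; _∨_; _∧_; _≟_)
open import Data.Bool.Properties using (∨-zeroʳ; ∨-identityʳ; ∧-zeroʳ; ∧-identityʳ; T-≡)
open import Data.Bool.ListAction using (any; or)
open import Data.Fin using (Fin; toℕ) renaming (zero to fzero; suc to fsuc)
open import Data.List as List
  using (List; []; _∷_; map; _++_; length; filter; upTo; allFin; tabulate)
open import Data.List.Properties
  using (∷-injective; ∷-injectiveˡ; ∷-injectiveʳ; ++-assoc; ++-identityʳ; ++-conicalʳ;
         length-++; map-tabulate; filter-accept; filter-reject; filter-idem; filter-++)
open import Data.List.Membership.Propositional using (_∈_; _∉_)
open import Data.List.Membership.Propositional.Properties
  using (∈-∃++; ∈-++⁻; ∈-++⁺ˡ; ∈-++⁺ʳ; ∈-map⁺; ∈-map⁻; ∈-upTo⁺; ∈-upTo⁻;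
         ∈-filter⁺; ∈-filter⁻; ∈-allFin)
open import Data.List.Relation.Binary.Subset.Propositional using (_⊆_)
open import Data.List.Relation.Unary.Any using (here; there)
open import Data.Vec as Vec using (Vec; lookup; toList; _[_]≔_)
open import Data.Vec.Properties using (tabulate-cong; toList-replicate)
open import Data.Product using (∃; ∃₂; _×_; _,_; proj₂)
open import Data.Sum using (_⊎_; inj₁; inj₂)
open import Function using (_∘_; id; Equivalence)
open import Relation.Nullary using (yes; no; contradiction)
open import Relation.Unary using (Decidable)
open import Relation.Binary.Definitions using (tri<; tri≈; tri>)
open import Relation.Binary.PropositionalEquality
  using (_≡_; _≢_; refl; sym; trans; cong; cong₂; subst; module ≡-Reasoning)
open ≡-Reasoning

-- mex

elemᵇ⇒∈ : ∀ {k} xs → elemᵇ k xs ≡ true → k ∈ xs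
elemᵇ⇒∈ {k} (x ∷ xs) k∈ᵇxs with k ≡ᵇ x in k≡ᵇx
... | true  = here (≡ᵇ⇒≡ k x (Equivalence.from T-≡ k≡ᵇx))
... | false = there (elemᵇ⇒∈ xs k∈ᵇxs)

∈⇒elemᵇ : ∀ {k xs} → k ∈ xs → elemᵇ k xs ≡ true
∈⇒elemᵇ {k} {_ ∷ xs} (here refl) = cong (_∨ elemᵇ k xs) (Equivalence.to T-≡ (≡⇒≡ᵇ k k refl))
∈⇒elemᵇ {k} {x ∷ _} (there k∈xs) =
  trans (cong ((k ≡ᵇ x) ∨_) (∈⇒elemᵇ k∈xs)) (∨-zeroʳ (k ≡ᵇ x))

covers⇒≤length : ∀ N xs → (∀ {m} → m < N → m ∈ xs) → N ≤ length xs
covers⇒≤length zero    xs _     = z≤n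
covers⇒≤length (suc N) xs cover with ys , zs , refl ← ∈-∃++ (cover ≤-refl) =
  subst (suc N ≤_) (sym length-split) (s≤s (covers⇒≤length N (ys ++ zs) cover′))
  where
  length-split : length (ys ++ N ∷ zs) ≡ suc (length (ys ++ zs))
  length-split = begin
    length (ys ++ N ∷ zs)        ≡⟨ length-++ ys ⟩
    length ys + suc (length zs)  ≡⟨ +-suc (length ys) (length zs) ⟩
    suc (length ys + length zs)  ≡⟨ cong suc (length-++ ys) ⟨
    suc (length (ys ++ zs))      ∎
  cover′ : ∀ {m} → m < N → m ∈ ys ++ zs
  cover′ m<N with ∈-++⁻ ys (cover (m<n⇒m<1+n m<N))
  ... | inj₁ m∈ys         = ∈-++⁺ˡ m∈ys
  ... | inj₂ (here refl)  = contradiction m<N (n≮n N)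
  ... | inj₂ (there m∈zs) = ∈-++⁺ʳ ys m∈zs

mexFrom-below : ∀ f {k m} xs → k ≤ m → m < mexFrom f k xs → elemᵇ m xs ≡ true
mexFrom-below zero        xs k≤m m<k = contradiction (≤-<-trans k≤m m<k) (n≮n _)
mexFrom-below (suc f) {k} xs k≤m m<r with elemᵇ k xs in k∈ᵇxs
... | false = contradiction (≤-<-trans k≤m m<r) (n≮n _)
... | true with m≤n⇒m<n∨m≡n k≤m
...   | inj₁ k<m  = mexFrom-below f xs k<m m<r
...   | inj₂ refl = k∈ᵇxs

mexFrom-exhausted-or-absent : ∀ f k xs →
  mexFrom f k xs ≡ f + k ⊎ elemᵇ (mexFrom f k xs) xs ≡ false
mexFrom-exhausted-or-absent zero    k xs = inj₁ refl
mexFrom-exhausted-or-absent (suc f) k xs with elemᵇ k xs in k∈ᵇxs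
... | false = inj₂ k∈ᵇxs
... | true with mexFrom-exhausted-or-absent f (suc k) xs
...   | inj₁ exhausted = inj₁ (trans exhausted (+-suc f k))
...   | inj₂ absent    = inj₂ absent

<mex⇒∈ : ∀ xs {m} → m < mex xs → m ∈ xs
<mex⇒∈ xs m<mex = elemᵇ⇒∈ xs (mexFrom-below (length xs) xs z≤n m<mex)

-- When the fuel runs out, 0, …, length xs all lie in xs: impossible by counting.
mex∉ : ∀ xs → mex xs ∉ xs
mex∉ xs mex∈xs with mexFrom-exhausted-or-absent (length xs) 0 xs
... | inj₂ absent    = contradiction (trans (sym (∈⇒elemᵇ mex∈xs)) absent) λ ()
... | inj₁ exhausted = n≮n (length xs) (covers⇒≤length (suc (length xs)) xs cover)
  where
  mex≡length : mex xs ≡ length xs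
  mex≡length = trans exhausted (+-identityʳ (length xs))
  cover : ∀ {m} → m < suc (length xs) → m ∈ xs
  cover m≤length with m≤n⇒m<n∨m≡n (≤-pred m≤length)
  ... | inj₁ m<length = <mex⇒∈ xs (subst (_ <_) (sym mex≡length) m<length)
  ... | inj₂ refl     = subst (_∈ xs) mex≡length mex∈xs

mex-cong : ∀ {xs ys} → xs ⊆ ys → ys ⊆ xs → mex xs ≡ mex ys
mex-cong {xs} {ys} xs⊆ys ys⊆xs with <-cmp (mex xs) (mex ys)
... | tri< mex<mex _ _ = contradiction (ys⊆xs (<mex⇒∈ ys mex<mex)) (mex∉ xs)
... | tri≈ _ mex≡mex _ = mex≡mex
... | tri> _ _ mex>mex = contradiction (xs⊆ys (<mex⇒∈ xs mex>mex)) (mex∉ ys)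

-- Runs of remaining vertices

[_]⁺ : ℕ → List ℕ
[ zero  ]⁺ = []
[ suc c ]⁺ = suc c ∷ []

-- The lengths of the maximal runs of trues; c counts the trues already read.
runsFrom : ℕ → List Bool → List ℕ
runsFrom c []          = [ c ]⁺
runsFrom c (true ∷ l)  = runsFrom (suc c) l
runsFrom c (false ∷ l) = [ c ]⁺ ++ runsFrom 0 l

runs : List Bool → List ℕ
runs = runsFrom 0

runsFrom-replicate : ∀ c r → runsFrom c (List.replicate r true) ≡ [ c + r ]⁺
runsFrom-replicate c zero    = cong [_]⁺ (sym (+-identityʳ c))
runsFrom-replicate c (suc r) = trans (runsFrom-replicate (suc c) r) (cong [_]⁺ (sym (+-suc c r)))

runsFrom-firstRun : ∀ l → ∃₂ λ b qs → ∀ c → runsFrom c l ≡ [ c + b ]⁺ ++ qs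
runsFrom-firstRun [] = 0 , [] , λ c → sym (trans (++-identityʳ _) (cong [_]⁺ (+-identityʳ c)))
runsFrom-firstRun (false ∷ l) = 0 , runs l , λ c → cong (λ x → [ x ]⁺ ++ runs l) (sym (+-identityʳ c))
runsFrom-firstRun (true ∷ l) with b , qs , firstRun ← runsFrom-firstRun l =
  suc b , qs , λ c → trans (firstRun (suc c)) (cong (λ x → [ x ]⁺ ++ qs) (sym (+-suc c b)))

runsFrom-suc⇒runs : ∀ {a b qs} l → runsFrom (suc a) l ≡ suc (a + b) ∷ qs → runs l ≡ [ b ]⁺ ++ qs
runsFrom-suc⇒runs {a} l eq with b′ , qs′ , firstRun ← runsFrom-firstRun l =
  trans (firstRun 0) (cong₂ (λ x ys → [ x ]⁺ ++ ys) b′≡b (∷-injectiveʳ eq′))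
  where
  eq′ = trans (sym (firstRun (suc a))) eq
  b′≡b = +-cancelˡ-≡ a _ _ (suc-injective (∷-injectiveˡ eq′))

-- The move shared by both games: an entry 1 + a + b is replaced by a and b, zeros omitted.
record Cut (before after : List ℕ) : Set where
  constructor cut
  field
    left right : List ℕ
    a b        : ℕ
    before≡    : before ≡ left ++ suc (a + b) ∷ right
    after≡     : after ≡ left ++ [ a ]⁺ ++ [ b ]⁺ ++ right

Cut-++ˡ : ∀ zs {xs ys} → Cut xs ys → Cut (zs ++ xs) (zs ++ ys)
Cut-++ˡ zs (cut left right a b refl refl) =
  cut (zs ++ left) right a b (sym (++-assoc zs left _)) (sym (++-assoc zs left _))

runsFrom-delete : ∀ c xs ys → Cut (runsFrom c (xs ++ true ∷ ys)) (runsFrom c (xs ++ false ∷ ys))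
runsFrom-delete c [] ys with b , qs , firstRun ← runsFrom-firstRun ys =
  cut [] qs c b (firstRun (suc c)) (cong ([ c ]⁺ ++_) (firstRun 0))
runsFrom-delete c (true  ∷ xs) ys = runsFrom-delete (suc c) xs ys
runsFrom-delete c (false ∷ xs) ys = Cut-++ˡ [ c ]⁺ (runsFrom-delete 0 xs ys)

DeletesTo : ℕ → List Bool → List ℕ → Set
DeletesTo c l qs = ∃₂ λ xs ys → l ≡ xs ++ true ∷ ys × runsFrom c (xs ++ false ∷ ys) ≡ qs

m≤n⇒m≢1+n+o : ∀ {m n o} → m ≤ n → m ≢ suc (n + o)
m≤n⇒m≢1+n+o {n = n} {o} m≤n refl = m+n≮m n o m≤n

runsFrom-deleteInFirstRun : ∀ {c} a b {qs} l → c ≤ a → runsFrom c l ≡ suc (a + b) ∷ qs →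
                            DeletesTo c l ([ a ]⁺ ++ [ b ]⁺ ++ qs)
runsFrom-deleteInFirstRun {zero}  a b []          _   ()
runsFrom-deleteInFirstRun {suc c} a b []          c<a eq = contradiction (∷-injectiveˡ eq) (m≤n⇒m≢1+n+o c<a)
runsFrom-deleteInFirstRun {suc c} a b (false ∷ l) c<a eq = contradiction (∷-injectiveˡ eq) (m≤n⇒m≢1+n+o c<a)
runsFrom-deleteInFirstRun {zero}  a b (false ∷ l) _   eq
  with xs , ys , refl , deleted ← runsFrom-deleteInFirstRun a b l z≤n eq = false ∷ xs , ys , refl , deleted
runsFrom-deleteInFirstRun {c}     a b (true ∷ l)  c≤a eq with m≤n⇒m<n∨m≡n c≤a
... | inj₁ c<a with xs , ys , refl , deleted ← runsFrom-deleteInFirstRun a b l c<a eq =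
  true ∷ xs , ys , refl , deleted
... | inj₂ refl = [] , l , refl , cong ([ c ]⁺ ++_) (runsFrom-suc⇒runs l eq)

runs-delete : ∀ qs a b {qs′} l → runs l ≡ qs ++ suc (a + b) ∷ qs′ →
              DeletesTo 0 l (qs ++ [ a ]⁺ ++ [ b ]⁺ ++ qs′)
runsFrom-deleteLater : ∀ c q qs a b {qs′} l → runsFrom c l ≡ q ∷ qs ++ suc (a + b) ∷ qs′ →
                       DeletesTo c l (q ∷ qs ++ [ a ]⁺ ++ [ b ]⁺ ++ qs′)

runs-delete []       a b l eq = runsFrom-deleteInFirstRun a b l z≤n eq
runs-delete (q ∷ qs) a b l eq = runsFrom-deleteLater 0 q qs a b l eq

runsFrom-deleteLater zero    q qs a b []          ()
runsFrom-deleteLater (suc c) q qs a b []          eq =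
  contradiction (++-conicalʳ qs _ (sym (∷-injectiveʳ eq))) λ ()
runsFrom-deleteLater c       q qs a b (true ∷ l)  eq
  with xs , ys , refl , deleted ← runsFrom-deleteLater (suc c) q qs a b l eq = true ∷ xs , ys , refl , deleted
runsFrom-deleteLater zero    q qs a b (false ∷ l) eq
  with xs , ys , refl , deleted ← runsFrom-deleteLater 0 q qs a b l eq = false ∷ xs , ys , refl , deleted
runsFrom-deleteLater (suc c) q qs a b (false ∷ l) eq with ∷-injective eq
... | refl , eq′ with xs , ys , refl , deleted ← runs-delete qs a b l eq′ =
  false ∷ xs , ys , refl , cong (suc c ∷_) deleted

Cut-runs⇒DeletesTo : ∀ l {qs} → Cut (runs l) qs → DeletesTo 0 l qs
Cut-runs⇒DeletesTo l (cut left right a b before≡ refl) = runs-delete left a b l before≡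

-- Pruning

headAlive : List Bool → Bool
headAlive []      = false
headAlive (x ∷ _) = x

-- p tells whether the left neighbour of the first vertex is alive.
pruneList : Bool → List Bool → List Bool
pruneList p []      = []
pruneList p (x ∷ l) = (x ∧ (p ∨ headAlive l)) ∷ pruneList x l

nontrivial : List ℕ → List ℕ
nontrivial = filter (2 ≤?_)

runs-prune : ∀ l → runs (pruneList false l) ≡ nontrivial (runs l)
runsFrom-prune-longRun : ∀ k l → runsFrom (2 + k) (pruneList true l) ≡ nontrivial (runsFrom (2 + k) l)

runs-prune []                 = refl
runs-prune (false ∷ l)        = runs-prune l
runs-prune (true ∷ [])        = refl
runs-prune (true ∷ false ∷ l) = runs-prune l
runs-prune (true ∷ true ∷ l)  = runsFrom-prune-longRun 0 l

runsFrom-prune-longRun k []          = refl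
runsFrom-prune-longRun k (true ∷ l)  = runsFrom-prune-longRun (suc k) l
runsFrom-prune-longRun k (false ∷ l) = cong (2 + k ∷_) (runs-prune l)

-- Grim on the path graph

pathNbr : ∀ {n} → Vec Bool n → Fin n → Bool
pathNbr {n} = Grim.hasNbr (pathGraph n)

any-allFin-suc : ∀ {n} (f : Fin (suc n) → Bool) → any f (allFin (suc n)) ≡ f fzero ∨ any (f ∘ fsuc) (allFin n)
any-allFin-suc f =
  cong (λ bs → f fzero ∨ or bs) (trans (map-tabulate fsuc f) (sym (map-tabulate id (f ∘ fsuc))))

any-false : ∀ {A : Set} {f : A → Bool} xs → (∀ x → f x ≡ false) → any f xs ≡ false
any-false []       _       = refl
any-false (x ∷ xs) f≡false rewrite f≡false x = any-false xs f≡false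

pathNbr-∷ : ∀ {n} x (S : Vec Bool n) v → pathNbr (x Vec.∷ S) v ≡
  (x ∧ pathAdj (suc n) v fzero) ∨ any (λ u → lookup S u ∧ pathAdj (suc n) v (fsuc u)) (allFin n)
pathNbr-∷ x S v = any-allFin-suc (λ u → lookup (x Vec.∷ S) u ∧ pathAdj _ v u)

pathNbr-zero : ∀ {n} x (S : Vec Bool n) → pathNbr (x Vec.∷ S) fzero ≡ headAlive (toList S)
pathNbr-zero {n} x S = begin
  pathNbr (x Vec.∷ S) fzero                            ≡⟨ pathNbr-∷ x S fzero ⟩
  (x ∧ false) ∨ any (nbrOf0 S) (allFin n)              ≡⟨ cong (_∨ any (nbrOf0 S) (allFin n)) (∧-zeroʳ x) ⟩
  any (nbrOf0 S) (allFin n)                            ≡⟨ vertex1Alive S ⟩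
  headAlive (toList S)                                 ∎
  where
  nbrOf0 : ∀ {n} → Vec Bool n → Fin n → Bool
  nbrOf0 {n} S u = lookup S u ∧ pathAdj (suc n) fzero (fsuc u)
  vertex1Alive : ∀ {n} (S : Vec Bool n) → any (nbrOf0 S) (allFin n) ≡ headAlive (toList S)
  vertex1Alive Vec.[]              = refl
  vertex1Alive {suc n} (y Vec.∷ S) = begin
    any (nbrOf0 (y Vec.∷ S)) (allFin (suc n))                ≡⟨ any-allFin-suc (nbrOf0 (y Vec.∷ S)) ⟩
    (y ∧ true) ∨ any (λ u → lookup S u ∧ false) (allFin n)  ≡⟨ cong₂ _∨_ (∧-identityʳ y) (any-false (allFin n) (∧-zeroʳ ∘ lookup S)) ⟩
    y ∨ false                                               ≡⟨ ∨-identityʳ y ⟩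
    y                                                       ∎

pathNbr-suc : ∀ {n} x (S : Vec Bool n) v → pathNbr (x Vec.∷ S) (fsuc v) ≡ (x ∧ (0 ≡ᵇ toℕ v)) ∨ pathNbr S v
pathNbr-suc x S v = pathNbr-∷ x S (fsuc v)

-- Vertex 0 has an extra alive left neighbour when p holds.
toList-pruneFrom : ∀ {n} p (S : Vec Bool n) →
  toList (Vec.tabulate (λ v → lookup S v ∧ ((p ∧ (0 ≡ᵇ toℕ v)) ∨ pathNbr S v))) ≡ pruneList p (toList S)
toList-pruneFrom p Vec.[]      = refl
toList-pruneFrom p (x Vec.∷ S) = cong₂ _∷_
  (cong (x ∧_) (cong₂ _∨_ (∧-identityʳ p) (pathNbr-zero x S)))
  (trans (cong toList (tabulate-cong λ v → cong (lookup S v ∧_) (cong₂ _∨_ (∧-zeroʳ p) (pathNbr-suc x S v))))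
         (toList-pruneFrom x S))

toList-prune : ∀ {n} (S : Vec Bool n) → toList (Grim.prune (pathGraph n) S) ≡ pruneList false (toList S)
toList-prune = toList-pruneFrom false

lookup≡true⇒toList-split : ∀ {n} (S : Vec Bool n) v → lookup S v ≡ true →
  ∃₂ λ xs ys → toList S ≡ xs ++ true ∷ ys × toList (S [ v ]≔ false) ≡ xs ++ false ∷ ys
lookup≡true⇒toList-split (x Vec.∷ S) fzero    refl = [] , toList S , refl , refl
lookup≡true⇒toList-split (x Vec.∷ S) (fsuc v) alive
  with xs , ys , S≡ , S[v]≡ ← lookup≡true⇒toList-split S v alive =
  x ∷ xs , ys , cong (x ∷_) S≡ , cong (x ∷_) S[v]≡

toList-split⇒lookup≡true : ∀ {n} (S : Vec Bool n) xs {ys} → toList S ≡ xs ++ true ∷ ys →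
  ∃ λ v → lookup S v ≡ true × toList (S [ v ]≔ false) ≡ xs ++ false ∷ ys
toList-split⇒lookup≡true Vec.[]      []      ()
toList-split⇒lookup≡true Vec.[]      (_ ∷ _) ()
toList-split⇒lookup≡true (x Vec.∷ S) []       S≡ with refl , S≡′ ← ∷-injective S≡ =
  fzero , refl , cong (false ∷_) S≡′
toList-split⇒lookup≡true (x Vec.∷ S) (_ ∷ xs) S≡ with refl , S≡′ ← ∷-injective S≡
  with v , alive , S[v]≡ ← toList-split⇒lookup≡true S xs S≡′ =
  fsuc v , alive , cong (x ∷_) S[v]≡

-- Octal .6

module _ {A : Set} {P : A → Set} (P? : Decidable P) where

  filter-split : ∀ xs {qs r qs′} → filter P? xs ≡ qs ++ r ∷ qs′ →
    ∃₂ λ ps ps′ → xs ≡ ps ++ r ∷ ps′ × filter P? ps ≡ qs × filter P? ps′ ≡ qs′ × P r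
  filter-split [] {qs} eq = contradiction (++-conicalʳ qs _ (sym eq)) λ ()
  filter-split (x ∷ xs) {qs} eq with P? x
  ... | no ¬Px with ps , ps′ , refl , ps≡ , ps′≡ , Pr ← filter-split xs eq =
    x ∷ ps , ps′ , refl , trans (filter-reject P? ¬Px) ps≡ , ps′≡ , Pr
  filter-split (x ∷ xs) {[]}     eq | yes Px with refl , xs≡ ← ∷-injective eq =
    [] , xs , refl , refl , xs≡ , Px
  filter-split (x ∷ xs) {_ ∷ qs} eq | yes Px with refl , eq′ ← ∷-injective eq
    with ps , ps′ , refl , ps≡ , ps′≡ , Pr ← filter-split xs eq′ =
    x ∷ ps , ps′ , refl , trans (filter-accept P? Px) (cong (x ∷_) ps≡) , ps′≡ , Pr

-- Equality up to heaps of size 0 and 1, which admit no move.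
infix 4 _≃_
record _≃_ (ps qs : List ℕ) : Set where
  constructor mk≃
  field nontrivial≡ : nontrivial ps ≡ nontrivial qs

open _≃_

≃-++ : ∀ {ps ps′ qs qs′} → ps ≃ ps′ → qs ≃ qs′ → (ps ++ qs) ≃ (ps′ ++ qs′)
≃-++ {ps} {ps′} {qs} {qs′} (mk≃ ps≃) (mk≃ qs≃) = mk≃ (begin
  nontrivial (ps ++ qs)             ≡⟨ filter-++ (2 ≤?_) ps qs ⟩
  nontrivial ps ++ nontrivial qs    ≡⟨ cong₂ _++_ ps≃ qs≃ ⟩
  nontrivial ps′ ++ nontrivial qs′  ≡⟨ filter-++ (2 ≤?_) ps′ qs′ ⟨
  nontrivial (ps′ ++ qs′)           ∎)

≃-++ˡ : ∀ zs {qs qs′} → qs ≃ qs′ → (zs ++ qs) ≃ (zs ++ qs′)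
≃-++ˡ zs = ≃-++ (mk≃ (refl {x = nontrivial zs}))

≃-sym : ∀ {ps qs} → ps ≃ qs → qs ≃ ps
≃-sym (mk≃ ps≃qs) = mk≃ (sym ps≃qs)

nontrivial-≃ : ∀ ps → nontrivial ps ≃ ps
nontrivial-≃ ps = mk≃ (filter-idem (2 ≤?_) ps)

[_]⁺-pos : ∀ {c} → 0 < c → [ c ]⁺ ≡ c ∷ []
[_]⁺-pos {suc c} _ = refl

∈-splitHeap⁺ : ∀ a b → 2 ≤ suc (a + b) → [ a ]⁺ ++ [ b ]⁺ ∈ splitHeap (suc (a + b))
∈-splitHeap⁺ zero    zero    (s≤s ())
∈-splitHeap⁺ zero    (suc b) _ = here refl
∈-splitHeap⁺ (suc a) zero    _ = here (cong (λ x → suc x ∷ []) (sym (+-identityʳ a)))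
∈-splitHeap⁺ (suc a) (suc b) _ =
  there (subst (_∈ map twoHeaps (upTo (a + suc b))) (cong (λ x → suc a ∷ x ∷ []) (m+n∸m≡n a (suc b)))
               (∈-map⁺ twoHeaps (∈-upTo⁺ (m<m+n a z<s))))
  where
  twoHeaps : ℕ → List ℕ
  twoHeaps c = suc c ∷ (a + suc b ∸ c) ∷ []

∈-splitHeap⁻ : ∀ {h ms} → ms ∈ splitHeap h →
  ∃₂ λ a b → 2 ≤ h × h ≡ suc (a + b) × ms ≡ [ a ]⁺ ++ [ b ]⁺
∈-splitHeap⁻ {suc (suc k)} (here refl) = 0 , suc k , s≤s (s≤s z≤n) , refl , refl
∈-splitHeap⁻ {suc (suc k)} (there ms∈) with c , c∈ , refl ← ∈-map⁻ (λ c → suc c ∷ (k ∸ c) ∷ []) ms∈ =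
  suc c , k ∸ c , s≤s (s≤s z≤n) ,
  cong (suc ∘ suc) (sym (m+[n∸m]≡n (<⇒≤ (∈-upTo⁻ c∈)))) ,
  cong (λ x → suc c ∷ x) (sym ([_]⁺-pos (m<n⇒0<n∸m (∈-upTo⁻ c∈))))

∈-octalMoves⁺ : ∀ ps {h ps′ ms} → ms ∈ splitHeap h → ps ++ ms ++ ps′ ∈ octalMoves (ps ++ h ∷ ps′)
∈-octalMoves⁺ []       {ps′ = ps′} ms∈ = ∈-++⁺ˡ (∈-map⁺ (_++ ps′) ms∈)
∈-octalMoves⁺ (p ∷ ps) {h} {ps′} ms∈ =
  ∈-++⁺ʳ (map (_++ (ps ++ h ∷ ps′)) (splitHeap p)) (∈-map⁺ (p ∷_) (∈-octalMoves⁺ ps ms∈))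

∈-octalMoves⁻ : ∀ p {p′} → p′ ∈ octalMoves p →
  ∃₂ λ ps ps′ → ∃₂ λ h ms → p ≡ ps ++ h ∷ ps′ × p′ ≡ ps ++ ms ++ ps′ × ms ∈ splitHeap h
∈-octalMoves⁻ (h ∷ hs) p′∈ with ∈-++⁻ (map (_++ hs) (splitHeap h)) p′∈
... | inj₁ p′∈split with ms , ms∈ , refl ← ∈-map⁻ (_++ hs) p′∈split = [] , hs , h , ms , refl , refl , ms∈
... | inj₂ p′∈rest with p″ , p″∈ , refl ← ∈-map⁻ (h ∷_) p′∈rest
  with ps , ps′ , h′ , ms , refl , refl , ms∈ ← ∈-octalMoves⁻ hs p″∈ =
  h ∷ ps , ps′ , h′ , ms , refl , refl , ms∈

octalMove⇐Cut : ∀ p {q} → Cut (nontrivial p) q → ∃ λ p′ → p′ ∈ octalMoves p × p′ ≃ q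
octalMove⇐Cut p (cut left right a b p≡ refl)
  with ps , ps′ , refl , refl , refl , 2≤r ← filter-split (2 ≤?_) p p≡ =
  ps ++ [ a ]⁺ ++ [ b ]⁺ ++ ps′ ,
  subst (_∈ octalMoves p) (cong (ps ++_) (++-assoc [ a ]⁺ [ b ]⁺ ps′)) (∈-octalMoves⁺ ps (∈-splitHeap⁺ a b 2≤r)) ,
  ≃-++ (≃-sym (nontrivial-≃ ps)) (≃-++ˡ [ a ]⁺ (≃-++ˡ [ b ]⁺ (≃-sym (nontrivial-≃ ps′))))

octalMove⇒Cut : ∀ p {p′} → p′ ∈ octalMoves p → ∃ λ q → Cut (nontrivial p) q × p′ ≃ q
octalMove⇒Cut p p′∈ with ps , ps′ , h , ms , refl , refl , ms∈ ← ∈-octalMoves⁻ p p′∈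
  with a , b , 2≤h , refl , refl ← ∈-splitHeap⁻ ms∈ =
  nontrivial ps ++ [ a ]⁺ ++ [ b ]⁺ ++ nontrivial ps′ ,
  cut (nontrivial ps) (nontrivial ps′) a b
      (trans (filter-++ (2 ≤?_) ps _) (cong (nontrivial ps ++_) (filter-accept (2 ≤?_) 2≤h))) refl ,
  subst (ps ++ ([ a ]⁺ ++ [ b ]⁺) ++ ps′ ≃_) (cong (nontrivial ps ++_) (++-assoc [ a ]⁺ [ b ]⁺ _))
        (≃-++ (≃-sym (nontrivial-≃ ps)) (≃-++ˡ ([ a ]⁺ ++ [ b ]⁺) (≃-sym (nontrivial-≃ ps′))))

-- The bisimulation

module PathBisimulation (n : ℕ) where
  open Grim (pathGraph n) using (options; move; sgFuel; start)

  Corresponds : Vec Bool n → List ℕ → Set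
  Corresponds S p = runs (toList S) ≡ nontrivial p

  ∈-options⁻ : ∀ {S S′} → S′ ∈ options S → ∃ λ v → lookup S v ≡ true × S′ ≡ move S v
  ∈-options⁻ {S} S′∈ with v , v∈ , refl ← ∈-map⁻ (move S) S′∈ =
    v , proj₂ (∈-filter⁻ (λ v → lookup S v ≟ true) {xs = allFin n} v∈) , refl

  ∈-options⁺ : ∀ {S v} → lookup S v ≡ true → move S v ∈ options S
  ∈-options⁺ {S} {v} alive = ∈-map⁺ (move S) (∈-filter⁺ (λ v → lookup S v ≟ true) (∈-allFin v) alive)

  runs-move : ∀ S v xs ys → toList (S [ v ]≔ false) ≡ xs ++ false ∷ ys →
              runs (toList (move S v)) ≡ nontrivial (runs (xs ++ false ∷ ys))
  runs-move S v xs ys S[v]≡ = begin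
    runs (toList (move S v))                          ≡⟨ cong runs (toList-prune (S [ v ]≔ false)) ⟩
    runs (pruneList false (toList (S [ v ]≔ false)))  ≡⟨ runs-prune (toList (S [ v ]≔ false)) ⟩
    nontrivial (runs (toList (S [ v ]≔ false)))       ≡⟨ cong (nontrivial ∘ runs) S[v]≡ ⟩
    nontrivial (runs (xs ++ false ∷ ys))              ∎

  grimMove⇒octalMove : ∀ S p {S′} → Corresponds S p → S′ ∈ options S →
                       ∃ λ p′ → p′ ∈ octalMoves p × Corresponds S′ p′
  grimMove⇒octalMove S p S~p S′∈ with v , alive , refl ← ∈-options⁻ {S} S′∈
    with xs , ys , S≡ , S[v]≡ ← lookup≡true⇒toList-split S v alive
    with p′ , p′∈ , p′≃ ← octalMove⇐Cut p (subst (λ qs → Cut qs (runs (xs ++ false ∷ ys)))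
                                                (trans (cong runs (sym S≡)) S~p) (runsFrom-delete 0 xs ys)) =
    p′ , p′∈ , trans (runs-move S v xs ys S[v]≡) (sym (nontrivial≡ p′≃))

  octalMove⇒grimMove : ∀ S p {p′} → Corresponds S p → p′ ∈ octalMoves p →
                       ∃ λ S′ → S′ ∈ options S × Corresponds S′ p′
  octalMove⇒grimMove S p S~p p′∈ with q , q-cut , p′≃q ← octalMove⇒Cut p p′∈
    with xs , ys , S≡ , runs≡q ← Cut-runs⇒DeletesTo (toList S) (subst (λ qs → Cut qs q) (sym S~p) q-cut)
    with v , alive , S[v]≡ ← toList-split⇒lookup≡true S xs S≡ =
    move S v , ∈-options⁺ {S} alive ,
    trans (runs-move S v xs ys S[v]≡) (trans (cong nontrivial runs≡q) (sym (nontrivial≡ p′≃q)))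

  sgFuel-correspond : ∀ f S p → Corresponds S p → sgFuel f S ≡ sgOctalFuel f p
  sgFuel-correspond zero    _ _ _ = refl
  sgFuel-correspond (suc f) S p S~p = mex-cong grim⊆octal octal⊆grim
    where
    grim⊆octal : map (sgFuel f) (options S) ⊆ map (sgOctalFuel f) (octalMoves p)
    grim⊆octal g∈ with S′ , S′∈ , refl ← ∈-map⁻ (sgFuel f) g∈
      with p′ , p′∈ , S′~p′ ← grimMove⇒octalMove S p S~p S′∈ =
      subst (_∈ _) (sym (sgFuel-correspond f S′ p′ S′~p′)) (∈-map⁺ (sgOctalFuel f) p′∈)
    octal⊆grim : map (sgOctalFuel f) (octalMoves p) ⊆ map (sgFuel f) (options S)
    octal⊆grim g∈ with p′ , p′∈ , refl ← ∈-map⁻ (sgOctalFuel f) g∈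
      with S′ , S′∈ , S′~p′ ← octalMove⇒grimMove S p S~p p′∈ =
      subst (_∈ _) (sgFuel-correspond f S′ p′ S′~p′) (∈-map⁺ (sgFuel f) S′∈)

  start-corresponds : Corresponds start (n ∷ [])
  start-corresponds = begin
    runs (toList start)                                          ≡⟨ cong runs (toList-prune (Vec.replicate n true)) ⟩
    runs (pruneList false (toList (Vec.replicate n true)))       ≡⟨ runs-prune (toList (Vec.replicate n true)) ⟩
    nontrivial (runs (toList (Vec.replicate n true)))            ≡⟨ cong (nontrivial ∘ runs) (toList-replicate n true) ⟩
    nontrivial (runs (List.replicate n true))                    ≡⟨ cong nontrivial (runsFrom-replicate 0 n) ⟩
    nontrivial [ n ]⁺                                            ≡⟨ nontrivial-[]⁺ n ⟩
    nontrivial (n ∷ [])                                          ∎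
    where
    nontrivial-[]⁺ : ∀ c → nontrivial [ c ]⁺ ≡ nontrivial (c ∷ [])
    nontrivial-[]⁺ zero    = refl
    nontrivial-[]⁺ (suc c) = refl

theorem5p4 : (n : ℕ) → sgGrim (pathGraph n) ≡ sgOctal (n ∷ [])
theorem5p4 n = begin
  sgGrim (pathGraph n)    ≡⟨ sgFuel-correspond n (Grim.start (pathGraph n)) (n ∷ []) start-corresponds ⟩
  sgOctalFuel n (n ∷ [])  ≡⟨ cong (λ f → sgOctalFuel f (n ∷ [])) (+-identityʳ n) ⟨
  sgOctal (n ∷ [])        ∎
  where open PathBisimulation n
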